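{- Let $\mathcal{M}$ be an $n$-maniplex, let $\mathcal{C}$ be an $\ell$-colouring of the facets of $\mathcal{M}$, and let $\omega$ be a $k$-weight function for $\mathcal{M}$. If the (edge-coloured) cross-cover $\mathcal{M}^\omega$ is a non-orientable maniplex, then $(2^{(\mathcal{M},\mathcal{C})})^{\omega_\mathcal{C}}$ is a non-orientable maniplex.
   Context: An $n$-maniplex is a connected $n$-valent simple graph with a proper edge-colouring by $\{0,\dots,n-1\}$ such that whenever $|i-j|>1$ the edges of colours $i,j$ form a disjoint union of $4$-cycles; it is non-orientable if not bipartite. Vertices are flags; $u^i$ is the $i$-neighbour of $u$. Facets are the connected components after deleting the edges of colour $n-1$. An $\ell$-colouring is a surjection $\mathcal{C}$ from facets to $\{1,\dots,\ell\}$; a flag's colour is its facet's colour. A $k$-weight function is a map $\omega\colon E(\mathcal{M})\to\mathbb{Z}_k$. The colour-coded extension $2^{(\mathcal{M},\mathcal{C})}$ is the $(n+1)$-maniplex with flag set $\mathcal{F}\times\mathbb{Z}_2^\ell$ ($\mathcal{F}$ the flags of $\mathcal{M}$), with $(u,x)^i=(u^i,x)$ for $i<n$ and $(u,x)^n=(u,x^j)$ where $j$ is the colour of $u$ and $x^j$ differs from $x$ only in coordinate $j$. The parity $\sigma(x)$ is $(-1)^b$ with $b$ the number of coordinates of $x$ equal to $1$. The extended weight $\omega_\mathcal{C}$ assigns to the $i$-edge joining $(u,x)$ and $(u^i,x)$ ($i<n$) the value $\sigma(x)\omega(uu^i)$, and $0$ to every $n$-edge. For an edge-coloured graph $\Gamma$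 with weight $\omega\colon E(\Gamma)\to\mathbb{Z}_k$, the cross-cover $\Gamma^\omega$ has vertex set $V(\Gamma)\times\mathbb{Z}_k$ with $(u,i)$ adjacent to $(v,\omega(e)-i)$ for each edge $e=uv$ and $i\in\mathbb{Z}_k$, the new edge receiving the colour of $e$. -}

module Defs where

open import Data.Nat using (ℕ; zero; suc; _+_; _∸_; _≤_; NonZero)
open import Data.Nat.DivMod using (_%_; m%n<n)
open import Data.Fin using (Fin; toℕ; fromℕ<; zero; suc)
open import Data.Bool using (Bool; true; false; not; _xor_; if_then_else_)
open import Data.Maybe using (Maybe; just; nothing)
import Data.Maybe as Maybe
open import Data.Vec using (Vec; []; _∷_; _[_]%=_)
open import Data.Product using (Σ; _×_; _,_; ∃)
open import Relation.Binary.PropositionalEquality using (_≡_; _≢_)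
open import Relation.Nullary using (¬_)

-- Edge-coloured graphs with colours Fin n in which every vertex has
-- exactly one edge of each colour are given by "i-neighbour" maps
-- nb i : V → V  (u ↦ u^i).

module _ {n : ℕ} {V : Set} (nb : Fin n → V → V) where

  data Reach (u : V) : V → Set where
    here : Reach u u
    step : ∀ {v} (i : Fin n) → Reach u v → Reach u (nb i v)

  record IsManiplex : Set where
    field
      inhabited   : V
      involutive  : ∀ i u → nb i (nb i u) ≡ u
      noLoops     : ∀ i u → nb i u ≢ u
      noMultiEdge : ∀ i j u → i ≢ j → nb i u ≢ nb j u
      fourCycles  : ∀ i j u → 2 + toℕ i ≤ toℕ j → nb i (nb j (nb i (nb j u))) ≡ u
      connected   : ∀ u v → Reach u v

  Bipartite : Set
  Bipartite = Σ (V → Bool) λ c → ∀ i u → c (nb i u) ≢ c u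

  NonOrientable : Set
  NonOrientable = ¬ Bipartite

-- ℤ_k represented by Fin k (k ≠ 0)

module _ {k : ℕ} {{_ : NonZero k}} where

  zeroK : Fin k
  zeroK = fromℕ< (m%n<n 0 k)

  _⊖_ : Fin k → Fin k → Fin k
  a ⊖ b = fromℕ< (m%n<n (toℕ a + (k ∸ toℕ b)) k)

  negK : Fin k → Fin k
  negK a = zeroK ⊖ a

-- a colour c : Fin (suc n) is either the last colour n (nothing) or
-- inject₁ j for j : Fin n (just j)

classify : ∀ {n} → Fin (suc n) → Maybe (Fin n)
classify {zero}  zero    = nothing
classify {suc n} zero    = just zero
classify {suc n} (suc i) = Maybe.map suc (classify i)

module _ {m : ℕ} {F : Set} (nb : Fin (suc m) → F → F) where

  -- ℓ-colouring of facets: a map on flags constant on facets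
  -- (components after deleting edges of colour n-1 = m), surjective
  record IsColouring {ℓ : ℕ} (C : F → Fin ℓ) : Set where
    field
      constOnFacets : ∀ i u → classify i ≢ nothing → C (nb i u) ≡ C u
      surjective    : ∀ c → ∃ λ u → C u ≡ c

  -- k-weight function: ω u i is the weight of the i-edge {u, u^i}
  IsWeight : ∀ {k} → (F → Fin (suc m) → Fin k) → Set
  IsWeight ω = ∀ i u → ω (nb i u) i ≡ ω u i

  extension : ∀ {ℓ} → (F → Fin ℓ) → Fin (suc (suc m)) → F × Vec Bool ℓ → F × Vec Bool ℓ
  extension C i (u , x) with classify i
  ... | just j  = (nb j u , x)
  ... | nothing = (u , x [ C u ]%= not)

-- odd number of coordinates equal to 1  (σ(x) = -1)
oddParity : ∀ {ℓ} → Vec Bool ℓ → Bool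
oddParity []       = false
oddParity (b ∷ xs) = b xor oddParity xs

extWeight : ∀ {m ℓ k} {{_ : NonZero k}} {F : Set} →
            (F → Fin (suc m) → Fin k) →
            F × Vec Bool ℓ → Fin (suc (suc m)) → Fin k
extWeight ω (u , x) i with classify i
... | just j  = if oddParity x then negK (ω u j) else ω u j
... | nothing = zeroK

crossCover : ∀ {n k} {{_ : NonZero k}} {V : Set} →
             (Fin n → V → V) → (V → Fin n → Fin k) →
             Fin n → V × Fin k → V × Fin k
crossCover nb ω i (u , a) = (nb i u , ω u i ⊖ a)

-- Each bit vector x : Vec Bool ℓ spans a layer of (2^(M,C))^ω_C, the flags ((u , x) , a),
-- and (u , a) ↦ ((u , x) , σ(x)·a) maps Mω isomorphically onto it, preserving the colours
-- < n: the twist by σ(x) undoes the sign in the weights σ(x)·ω. Everything about colours < n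
-- (involutions, loops, 4-cycles, connectivity within a layer) is therefore inherited from Mω,
-- and a proper 2-colouring of the extension would restrict to one of Mω. An n-edge flips the
-- bit C u and negates the weight; surjectivity of C lets these edges connect all layers, and
-- the 4-cycles of colours i < n-1 and n close up because C is constant along i-edges.
module Submission where

open import Defs
open import Data.Nat using (ℕ; zero; suc; _+_; _∸_; _≤_; _<_; NonZero; s≤s⁻¹)
open import Data.Nat.Properties
  using (+-assoc; +-comm; m+[n∸m]≡n; m∸n+n≡m; <⇒≤; <⇒≱; <-irrefl; +-commutativeSemigroup)
open import Data.Nat.DivMod using (_%_; m%n%n≡m%n; [m+n]%n≡m%n; %-distribˡ-+; m<n⇒m%n≡m)
open import Algebra.Properties.CommutativeSemigroup +-commutativeSemigroup using (interchange)
open import Data.Fin using (Fin; toℕ; zero; suc; inject₁; fromℕ; _≟_)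
open import Data.Fin.Properties
  using (toℕ-fromℕ<; toℕ-fromℕ; toℕ-inject₁; toℕ-injective; toℕ<n)
open import Data.Fin.Relation.Unary.Top using (view; ‵fromℕ; ‵inject₁)
open import Data.Bool using (Bool; true; false; not; _xor_; if_then_else_)
open import Data.Bool.Properties using (not-involutive; not-¬; not-distribˡ-xor; not-distribʳ-xor)
open import Data.Maybe using (just; nothing)
import Data.Maybe as Maybe
open import Data.Vec using (Vec; []; _∷_; _[_]%=_; lookup; replicate)
open import Data.Vec.Properties using (updateAt-updateAt-local; updateAt-id; lookup∘updateAt)
open import Data.Product using (_×_; _,_; proj₁; proj₂)
open import Data.Empty using (⊥-elim)
open import Function using (_∘_)
open import Relation.Binary.Core using (Rel)
open import Relation.Binary.Definitions using (Reflexive; Transitive)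
open import Relation.Nullary using (yes; no)
open import Relation.Binary.Bundles using (Setoid)
import Relation.Binary.Construct.On as On
import Relation.Binary.Reasoning.Setoid as SetoidReasoning
open import Relation.Binary.PropositionalEquality
open import Level using (0ℓ)

module _ {k : ℕ} {{_ : NonZero k}} where

  ≡-mod : Setoid 0ℓ 0ℓ
  ≡-mod = On.setoid (setoid ℕ) (_% k)

  open Setoid ≡-mod using (_≈_)
  private module ≈-Reasoning = SetoidReasoning ≡-mod

  %-≈ : ∀ x → x % k ≈ x
  %-≈ x = m%n%n≡m%n x k

  +k-≈ : ∀ x → x + k ≈ x
  +k-≈ x = [m+n]%n≡m%n x k

  +-≈ : ∀ {x x′ y y′} → x ≈ x′ → y ≈ y′ → x + y ≈ x′ + y′
  +-≈ {x} {x′} {y} {y′} x≈x′ y≈y′ = begin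
    (x + y) % k               ≡⟨ %-distribˡ-+ x y k ⟩
    (x % k + y % k) % k       ≡⟨ cong₂ (λ a b → (a + b) % k) x≈x′ y≈y′ ⟩
    (x′ % k + y′ % k) % k     ≡⟨ %-distribˡ-+ x′ y′ k ⟨
    (x′ + y′) % k             ∎
    where open ≡-Reasoning

  toℕ-zeroK : toℕ (zeroK {k}) ≈ 0
  toℕ-zeroK = trans (cong (_% k) (toℕ-fromℕ< _)) (%-≈ 0)

  toℕ-⊖ : ∀ (a b : Fin k) → toℕ (a ⊖ b) + toℕ b ≈ toℕ a
  toℕ-⊖ a b = begin
    toℕ (a ⊖ b) + toℕ b               ≡⟨ cong (_+ toℕ b) (toℕ-fromℕ< _) ⟩
    (toℕ a + (k ∸ toℕ b)) % k + toℕ b ≈⟨ +-≈ (%-≈ _) refl ⟩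
    toℕ a + (k ∸ toℕ b) + toℕ b       ≡⟨ +-assoc (toℕ a) _ _ ⟩
    toℕ a + ((k ∸ toℕ b) + toℕ b)     ≡⟨ cong (toℕ a +_) (m∸n+n≡m (<⇒≤ (toℕ<n b))) ⟩
    toℕ a + k                         ≈⟨ +k-≈ (toℕ a) ⟩
    toℕ a                             ∎
    where open ≈-Reasoning

  +-cancelʳ-≈ : ∀ {x y} (b : Fin k) → x + toℕ b ≈ y + toℕ b → x ≈ y
  +-cancelʳ-≈ {x} {y} b x+b≈y+b = begin
    x                       ≈⟨ cancel x ⟨
    x + toℕ b + (k ∸ toℕ b) ≈⟨ +-≈ x+b≈y+b refl ⟩
    y + toℕ b + (k ∸ toℕ b) ≈⟨ cancel y ⟩
    y                       ∎
    where
    open ≈-Reasoning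
    cancel : ∀ z → z + toℕ b + (k ∸ toℕ b) ≈ z
    cancel z = begin
      z + toℕ b + (k ∸ toℕ b)   ≡⟨ +-assoc z _ _ ⟩
      z + (toℕ b + (k ∸ toℕ b)) ≡⟨ cong (z +_) (m+[n∸m]≡n (<⇒≤ (toℕ<n b))) ⟩
      z + k                     ≈⟨ +k-≈ z ⟩
      z                         ∎

  toℕ-injective-≈ : ∀ {a b : Fin k} → toℕ a ≈ toℕ b → a ≡ b
  toℕ-injective-≈ {a} {b} a≈b =
    toℕ-injective (trans (sym (m<n⇒m%n≡m (toℕ<n a))) (trans a≈b (m<n⇒m%n≡m (toℕ<n b))))

  ⊖-unique : ∀ {a b c : Fin k} → toℕ c + toℕ b ≈ toℕ a → c ≡ a ⊖ b
  ⊖-unique {a} {b} c+b≈a = toℕ-injective-≈ (+-cancelʳ-≈ b (trans c+b≈a (sym (toℕ-⊖ a b))))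

  ⊖-involutive : ∀ (b a : Fin k) → b ⊖ (b ⊖ a) ≡ a
  ⊖-involutive b a = sym (⊖-unique (trans (cong (_% k) (+-comm (toℕ a) _)) (toℕ-⊖ b a)))

  negK-involutive : ∀ (a : Fin k) → negK (negK a) ≡ a
  negK-involutive = ⊖-involutive zeroK

  negK-⊖ : ∀ (w a : Fin k) → negK w ⊖ negK a ≡ negK (w ⊖ a)
  negK-⊖ w a = sym (⊖-unique (+-cancelʳ-≈ w (begin
    toℕ (negK (w ⊖ a)) + toℕ (negK a) + toℕ w
      ≈⟨ +-≈ refl (toℕ-⊖ w a) ⟨
    toℕ (negK (w ⊖ a)) + toℕ (negK a) + (toℕ (w ⊖ a) + toℕ a)
      ≡⟨ interchange (toℕ (negK (w ⊖ a))) _ _ _ ⟩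
    (toℕ (negK (w ⊖ a)) + toℕ (w ⊖ a)) + (toℕ (negK a) + toℕ a)
      ≈⟨ +-≈ (toℕ-⊖ zeroK (w ⊖ a)) (toℕ-⊖ zeroK a) ⟩
    toℕ (zeroK {k}) + toℕ (zeroK {k})
      ≈⟨ +-≈ toℕ-zeroK toℕ-zeroK ⟩
    0
      ≈⟨ trans (toℕ-⊖ zeroK w) toℕ-zeroK ⟨
    toℕ (negK w) + toℕ w
      ∎)))
    where open ≈-Reasoning

classify-inject₁ : ∀ {n} (j : Fin n) → classify (inject₁ j) ≡ just j
classify-inject₁ {suc zero}    zero    = refl
classify-inject₁ {suc (suc n)} zero    = refl
classify-inject₁ {suc (suc n)} (suc j) = cong (Maybe.map suc) (classify-inject₁ j)

classify-fromℕ : ∀ n → classify (fromℕ n) ≡ nothing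
classify-fromℕ zero    = refl
classify-fromℕ (suc n) = cong (Maybe.map suc) (classify-fromℕ n)

<n⇒classify≢nothing : ∀ {n} (i : Fin (suc n)) → toℕ i < n → classify i ≢ nothing
<n⇒classify≢nothing i i<n with view i
... | ‵inject₁ j rewrite classify-inject₁ j = λ ()
... | ‵fromℕ     = ⊥-elim (<-irrefl (toℕ-fromℕ _) i<n)

flip-involutive : ∀ {ℓ} (x : Vec Bool ℓ) c → x [ c ]%= not [ c ]%= not ≡ x
flip-involutive x c = trans (updateAt-updateAt-local c x (not-involutive _)) (updateAt-id c x)

flip-≢ : ∀ {ℓ} (x : Vec Bool ℓ) c → x [ c ]%= not ≢ x
flip-≢ x c flipped≡x =
  not-¬ refl (trans (cong (λ y → lookup y c) (sym flipped≡x)) (lookup∘updateAt c x))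

oddParity-flip : ∀ {ℓ} (x : Vec Bool ℓ) c → oddParity (x [ c ]%= not) ≡ not (oddParity x)
oddParity-flip (b ∷ x) zero    = sym (not-distribˡ-xor b (oddParity x))
oddParity-flip (b ∷ x) (suc c) =
  trans (cong (b xor_) (oddParity-flip x c)) (sym (not-distribʳ-xor b (oddParity x)))

flip-closed⇒total : ∀ {ℓ} (R : Rel (Vec Bool ℓ) 0ℓ) → Reflexive R → Transitive R →
                    (∀ x c → R x (x [ c ]%= not)) → ∀ x y → R x y
flip-closed⇒total R refl′ trans′ flip [] [] = refl′
flip-closed⇒total R refl′ trans′ flip (b ∷ x) (c ∷ y) =
  trans′ (head b c) (flip-closed⇒total (λ x′ y′ → R (c ∷ x′) (c ∷ y′)) refl′ trans′
                                         (λ x′ i → flip (c ∷ x′) (suc i)) x y)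
  where
  head : ∀ b c → R (b ∷ x) (c ∷ x)
  head false false = refl′
  head true  true  = refl′
  head false true  = flip _ zero
  head true  false = flip _ zero

module _ {ℓ k : ℕ} {{_ : NonZero k}} where

  σ : Vec Bool ℓ → Fin k → Fin k
  σ x a = if oddParity x then negK a else a

  σ-involutive : ∀ x a → σ x (σ x a) ≡ a
  σ-involutive x a with oddParity x
  ... | true  = negK-involutive a
  ... | false = refl

  σ-⊖ : ∀ x w a → σ x w ⊖ σ x a ≡ σ x (w ⊖ a)
  σ-⊖ x w a with oddParity x
  ... | true  = negK-⊖ w a
  ... | false = refl

  σ-flip : ∀ x c a → σ (x [ c ]%= not) a ≡ negK (σ x a)
  σ-flip x c a rewrite oddParity-flip x c with oddParity x
  ... | true  = sym (negK-involutive a)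
  ... | false = refl

module _ {n : ℕ} {V : Set} {nb : Fin n → V → V} where

  Reach-trans : ∀ {u v w} → Reach nb u v → Reach nb v w → Reach nb u w
  Reach-trans u⇝v here         = u⇝v
  Reach-trans u⇝v (step i v⇝w) = step i (Reach-trans u⇝v v⇝w)

module _ {n n′ : ℕ} {V W : Set} {nb : Fin n → V → V} {nb′ : Fin n′ → W → W}
         (g : Fin n → Fin n′) (f : V → W)
         (f-hom : ∀ i v → f (nb i v) ≡ nb′ (g i) (f v)) where

  Reach-map : ∀ {u v} → Reach nb u v → Reach nb′ (f u) (f v)
  Reach-map here         = here
  Reach-map (step i u⇝v) = subst (Reach nb′ _) (sym (f-hom i _)) (step (g i) (Reach-map u⇝v))

  Bipartite-pullback : Bipartite nb′ → Bipartite nb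
  Bipartite-pullback (c , c-proper) =
    c ∘ f , λ i v c[nb]≡c → c-proper (g i) (f v) (trans (cong c (sym (f-hom i v))) c[nb]≡c)

module Extension {m ℓ k : ℕ} {{_ : NonZero k}} {F : Set} (r : Fin (suc m) → F → F)
                 (C : F → Fin ℓ) (ω : F → Fin (suc m) → Fin k) where

  Flag : Set
  Flag = (F × Vec Bool ℓ) × Fin k

  Mω : Fin (suc m) → F × Fin k → F × Fin k
  Mω = crossCover r ω

  Eω : Fin (suc (suc m)) → Flag → Flag
  Eω = crossCover (extension r C) (extWeight ω)

  top : Fin (suc (suc m))
  top = fromℕ (suc m)

  Eω-inject₁ : ∀ j u x a → Eω (inject₁ j) ((u , x) , a) ≡ ((r j u , x) , σ x (ω u j) ⊖ a)
  Eω-inject₁ j u x a rewrite classify-inject₁ j = refl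

  Eω-top : ∀ u x a → Eω top ((u , x) , a) ≡ ((u , x [ C u ]%= not) , negK a)
  Eω-top u x a rewrite classify-fromℕ (suc m) = refl

  layer : Vec Bool ℓ → F × Fin k → Flag
  layer x (u , a) = ((u , x) , σ x a)

  layer-hom : ∀ x j q → layer x (Mω j q) ≡ Eω (inject₁ j) (layer x q)
  layer-hom x j (u , a) =
    trans (cong ((r j u , x) ,_) (sym (σ-⊖ x (ω u j) a))) (sym (Eω-inject₁ j u x (σ x a)))

  layer-onto : ∀ x u a → layer x (u , σ x a) ≡ ((u , x) , a)
  layer-onto x u a = cong ((u , x) ,_) (σ-involutive x a)

  layer-elim : (P : Flag → Set) → (∀ x q → P (layer x q)) → ∀ p → P p
  layer-elim P P-layer ((u , x) , a) = subst P (layer-onto x u a) (P-layer x (u , σ x a))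

  Eω-nonOrientable : NonOrientable Mω → NonOrientable Eω
  Eω-nonOrientable Mω-nonOrientable =
    Mω-nonOrientable ∘ Bipartite-pullback inject₁ (layer (replicate ℓ false)) (layer-hom _)

  base : Flag → F
  base = proj₁ ∘ proj₁

  bits : Flag → Vec Bool ℓ
  bits = proj₂ ∘ proj₁

  module _ (r-maniplex : IsManiplex r) (C-colouring : IsColouring r C) (ω-weight : IsWeight r ω)
           (Mω-maniplex : IsManiplex Mω) where

    private
      module M  = IsManiplex r-maniplex
      module M′ = IsManiplex Mω-maniplex
      module 𝒞  = IsColouring C-colouring
      open ≡-Reasoning

    Eω-involutive : ∀ i p → Eω i (Eω i p) ≡ p
    Eω-involutive i with view i
    ... | ‵inject₁ j = layer-elim _ λ x q → begin
          Eω (inject₁ j) (Eω (inject₁ j) (layer x q))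
            ≡⟨ cong (Eω (inject₁ j)) (layer-hom x j q) ⟨
          Eω (inject₁ j) (layer x (Mω j q))
            ≡⟨ layer-hom x j (Mω j q) ⟨
          layer x (Mω j (Mω j q))
            ≡⟨ cong (layer x) (M′.involutive j q) ⟩
          layer x q ∎
    ... | ‵fromℕ = λ { ((u , x) , a) → begin
          Eω top (Eω top ((u , x) , a))
            ≡⟨ cong (Eω top) (Eω-top u x a) ⟩
          Eω top ((u , x [ C u ]%= not) , negK a)
            ≡⟨ Eω-top u _ (negK a) ⟩
          ((u , x [ C u ]%= not [ C u ]%= not) , negK (negK a))
            ≡⟨ cong₂ (λ y b → ((u , y) , b)) (flip-involutive x (C u)) (negK-involutive a) ⟩
          ((u , x) , a) ∎ }

    Eω-noLoops : ∀ i p → Eω i p ≢ p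
    Eω-noLoops i ((u , x) , a) with view i
    ... | ‵inject₁ j rewrite Eω-inject₁ j u x a = M.noLoops j u ∘ cong base
    ... | ‵fromℕ     rewrite Eω-top u x a     = flip-≢ x (C u) ∘ cong bits

    Eω-noMultiEdge : ∀ i i′ p → i ≢ i′ → Eω i p ≢ Eω i′ p
    Eω-noMultiEdge i i′ ((u , x) , a) i≢i′ with view i | view i′
    ... | ‵inject₁ j | ‵inject₁ j′ rewrite Eω-inject₁ j u x a | Eω-inject₁ j′ u x a with j ≟ j′
    ...   | yes refl = ⊥-elim (i≢i′ refl)
    ...   | no j≢j′  = M.noMultiEdge j j′ u j≢j′ ∘ cong base
    Eω-noMultiEdge i i′ ((u , x) , a) i≢i′ | ‵inject₁ j | ‵fromℕ
      rewrite Eω-inject₁ j u x a | Eω-top u x a = M.noLoops j u ∘ cong base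
    Eω-noMultiEdge i i′ ((u , x) , a) i≢i′ | ‵fromℕ | ‵inject₁ j′
      rewrite Eω-inject₁ j′ u x a | Eω-top u x a = M.noLoops j′ u ∘ sym ∘ cong base
    Eω-noMultiEdge i i′ ((u , x) , a) i≢i′ | ‵fromℕ | ‵fromℕ = ⊥-elim (i≢i′ refl)

    inner-fourCycles : ∀ a b → 2 + toℕ a ≤ toℕ b → ∀ p →
                       Eω (inject₁ a) (Eω (inject₁ b) (Eω (inject₁ a) (Eω (inject₁ b) p))) ≡ p
    inner-fourCycles a b a+2≤b = layer-elim _ λ x q → begin
      Eω i (Eω j (Eω i (Eω j (layer x q)))) ≡⟨ cong (Eω i ∘ Eω j ∘ Eω i) (layer-hom x b q) ⟨
      Eω i (Eω j (Eω i (layer x (Mω b q)))) ≡⟨ cong (Eω i ∘ Eω j) (layer-hom x a _) ⟨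
      Eω i (Eω j (layer x (Mω a (Mω b q)))) ≡⟨ cong (Eω i) (layer-hom x b _) ⟨
      Eω i (layer x (Mω b (Mω a (Mω b q)))) ≡⟨ layer-hom x a _ ⟨
      layer x (Mω a (Mω b (Mω a (Mω b q)))) ≡⟨ cong (layer x) (M′.fourCycles a b q a+2≤b) ⟩
      layer x q                             ∎
      where
      i = inject₁ a
      j = inject₁ b

    -- The second n-edge flips the bit C u back, as C is constant along a-edges; the two a-edges
    -- are then crossed under the opposite signs σ x₁ = negK ∘ σ x, so their weights cancel.
    inner-top-fourCycles : ∀ a → classify a ≢ nothing → ∀ p →
                           Eω (inject₁ a) (Eω top (Eω (inject₁ a) (Eω top p))) ≡ p
    inner-top-fourCycles a a-inner ((u , x) , a₀) = begin
      Eω i (Eω top (Eω i (Eω top ((u , x) , a₀))))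
        ≡⟨ cong (Eω i ∘ Eω top ∘ Eω i) (Eω-top u x a₀) ⟩
      Eω i (Eω top (Eω i ((u , x₁) , negK a₀)))
        ≡⟨ cong (Eω i ∘ Eω top) (Eω-inject₁ a u x₁ (negK a₀)) ⟩
      Eω i (Eω top ((r a u , x₁) , t))
        ≡⟨ cong (Eω i) (Eω-top (r a u) x₁ t) ⟩
      Eω i ((r a u , x₂) , negK t)
        ≡⟨ Eω-inject₁ a (r a u) x₂ (negK t) ⟩
      ((r a (r a u) , x₂) , σ x₂ (ω (r a u) a) ⊖ negK t)
        ≡⟨ cong₂ (λ v y → ((v , y) , σ y (ω (r a u) a) ⊖ negK t)) (M.involutive a u) x₂≡x ⟩
      ((u , x) , σ x (ω (r a u) a) ⊖ negK t)
        ≡⟨ cong (λ w → ((u , x) , σ x w ⊖ negK t)) (ω-weight a u) ⟩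
      ((u , x) , s ⊖ negK t)
        ≡⟨ cong ((u , x) ,_) s⊖negKt≡a₀ ⟩
      ((u , x) , a₀)
        ∎
      where
      i = inject₁ a
      x₁ = x [ C u ]%= not
      x₂ = x₁ [ C (r a u) ]%= not
      s = σ x (ω u a)
      t = σ x₁ (ω u a) ⊖ negK a₀
      x₂≡x : x₂ ≡ x
      x₂≡x = trans (cong (x₁ [_]%= not) (𝒞.constOnFacets a u a-inner)) (flip-involutive x (C u))
      s⊖negKt≡a₀ : s ⊖ negK t ≡ a₀
      s⊖negKt≡a₀ = begin
        s ⊖ negK (σ x₁ (ω u a) ⊖ negK a₀) ≡⟨ cong (λ s′ → s ⊖ negK (s′ ⊖ negK a₀)) (σ-flip x _ _) ⟩
        s ⊖ negK (negK s ⊖ negK a₀)       ≡⟨ cong (s ⊖_ ∘ negK) (negK-⊖ s a₀) ⟩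
        s ⊖ negK (negK (s ⊖ a₀))          ≡⟨ cong (s ⊖_) (negK-involutive (s ⊖ a₀)) ⟩
        s ⊖ (s ⊖ a₀)                      ≡⟨ ⊖-involutive s a₀ ⟩
        a₀                                ∎

    Eω-fourCycles : ∀ i j p → 2 + toℕ i ≤ toℕ j → Eω i (Eω j (Eω i (Eω j p))) ≡ p
    Eω-fourCycles i j p i+2≤j with view i | view j
    ... | ‵inject₁ a | ‵inject₁ b rewrite toℕ-inject₁ a | toℕ-inject₁ b =
      inner-fourCycles a b i+2≤j p
    ... | ‵inject₁ a | ‵fromℕ rewrite toℕ-inject₁ a | toℕ-fromℕ (suc m) =
      inner-top-fourCycles a (<n⇒classify≢nothing a (s≤s⁻¹ i+2≤j)) p
    ... | ‵fromℕ | _ rewrite toℕ-fromℕ (suc m) = ⊥-elim (<⇒≱ (toℕ<n j) (<⇒≤ i+2≤j))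

    layer-connected : ∀ x u a v b → Reach Eω ((u , x) , a) ((v , x) , b)
    layer-connected x u a v b =
      subst₂ (Reach Eω) (layer-onto x u a) (layer-onto x v b)
        (Reach-map inject₁ (layer x) (layer-hom x) (M′.connected (u , σ x a) (v , σ x b)))

    flip-reachable : ∀ x c u a v b → Reach Eω ((u , x) , a) ((v , x [ c ]%= not) , b)
    flip-reachable x c u a v b with 𝒞.surjective c
    ... | w , refl =
      Reach-trans (layer-connected x u a w a)
        (Reach-trans (subst (Reach Eω _) (Eω-top w x a) (step top here))
                     (layer-connected _ w (negK a) v b))

    Eω-connected : ∀ p p′ → Reach Eω p p′
    Eω-connected ((u , x) , a) ((v , y) , b) = flip-closed⇒total BitsReach
      (λ {x} → layer-connected x)
      (λ x⇝y y⇝z u a v b → Reach-trans (x⇝y u a v b) (y⇝z v b v b))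
      flip-reachable x y u a v b
      where
      BitsReach : Rel (Vec Bool ℓ) 0ℓ
      BitsReach x y = ∀ u a v b → Reach Eω ((u , x) , a) ((v , y) , b)

    Eω-maniplex : IsManiplex Eω
    Eω-maniplex = record
      { inhabited   = (M.inhabited , replicate ℓ false) , zeroK
      ; involutive  = Eω-involutive
      ; noLoops     = Eω-noLoops
      ; noMultiEdge = Eω-noMultiEdge
      ; fourCycles  = Eω-fourCycles
      ; connected   = Eω-connected
      }

proposition5p5 : {m ℓ k : ℕ} {{_ : NonZero k}} (F : Set) (r : Fin (suc m) → F → F)
    → IsManiplex r
    → (C : F → Fin ℓ) → IsColouring r C
    → (ω : F → Fin (suc m) → Fin k) → IsWeight r ω
    → IsManiplex (crossCover r ω) → NonOrientable (crossCover r ω)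
    → IsManiplex (crossCover (extension r C) (extWeight ω))
      × NonOrientable (crossCover (extension r C) (extWeight ω))
proposition5p5 F r r-maniplex C C-colouring ω ω-weight Mω-maniplex Mω-nonOrientable =
  Eω-maniplex r-maniplex C-colouring ω-weight Mω-maniplex , Eω-nonOrientable Mω-nonOrientable
  where open Extension r C ω
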